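{- Let $T$ be an oriented graph on $n$ vertices with $\delta(T)\ge n-k$. Then $T$ has a path cover consisting of at most $k$ paths.
   Context: An oriented graph is a digraph without loops with at most one edge between any two vertices. $\delta(T)=\min\{d^+(x)+d^-(x):x\in V(T)\}$. A path cover of $T$ is a collection of vertex-disjoint directed paths in $T$ (single vertices allowed) which together cover all vertices of $T$. -}

module Defs where

open import Data.Nat using (ℕ; suc; _∸_; _≤_; _+_)
open import Data.Fin using (Fin)
open import Data.List using (List; []; _∷_; length; filter; concat)
open import Data.List.Relation.Binary.Permutation.Propositional using (_↭_)
open import Data.Product using (_×_)
open import Relation.Nullary using (¬_; Dec)
open import Relation.Binary using (Rel; Decidable)
import Data.List.Membership.Propositional
open import Data.List using (allFin) public

record OrientedGraph (n : ℕ) : Set₁ where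
  field
    Arc         : Rel (Fin n) _
    arc?        : Decidable Arc
    loopless    : ∀ x → ¬ Arc x x
    asymmetric  : ∀ x y → Arc x y → ¬ Arc y x

module _ {n : ℕ} (T : OrientedGraph n) where
  open OrientedGraph T

  outdeg : Fin n → ℕ
  outdeg x = length (filter (λ y → arc? x y) (allFin n))

  indeg : Fin n → ℕ
  indeg x = length (filter (λ y → arc? y x) (allFin n))

  deg : Fin n → ℕ
  deg x = outdeg x + indeg x

  MinDegreeAtLeast : ℕ → Set
  MinDegreeAtLeast m = ∀ x → m ≤ deg x

  -- a directed path as its nonempty list of vertices, consecutive ones
  -- joined by arcs (vertex distinctness across/within paths is enforced
  -- by the permutation condition in IsPathCover)
  data IsPath : List (Fin n) → Set where
    single : ∀ x → IsPath (x ∷ [])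
    step   : ∀ x y {vs} → Arc x y → IsPath (y ∷ vs) → IsPath (x ∷ y ∷ vs)

  record IsPathCover (ps : List (List (Fin n))) : Set where
    field
      allPaths  : ∀ {p} → p Data.List.Membership.Propositional.∈ ps → IsPath p
      partition : concat ps ↭ allFin n

-- Build the cover greedily, adding one vertex x at a time to a cover of the
-- vertices seen so far. While there are fewer than k paths, x becomes a new
-- path. Otherwise, if some path consists entirely of neighbours of x, then x
-- can be inserted into it: before the first vertex y with x → y, or at the end
-- if there is none. If every path contains a non-neighbour of x, then x has at
-- least k non-neighbours besides itself, so deg x ≤ n − k − 1 < δ(T).
module Submission where

open import Defs
open import Data.Nat using (ℕ; suc; _∸_; _≤_; _+_; z≤n; s≤s; _<?_)
open import Data.Nat.Properties
  using (+-suc; +-comm; +-mono-≤; +-cancelˡ-≤; ≤-refl; ≮⇒≥; m≤n+m; m≤n+m∸n; n≮n; module ≤-Reasoning)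
open import Data.List using (List; []; _∷_; length; filter; concat; _++_; [_])
open import Data.List.Properties using (length-++; filter-++; filter-accept; filter-some; ++-assoc; length-tabulate)
open import Data.List.Relation.Unary.All as All using (All; []; _∷_; all?)
open import Data.List.Relation.Unary.All.Properties using (¬All⇒Any¬)
open import Data.List.Relation.Unary.Any using (Any; here; there)
open import Data.List.Relation.Binary.Permutation.Propositional using (_↭_; prep; swap; ↭-refl; ↭-trans)
open import Data.List.Relation.Binary.Permutation.Propositional.Properties
  using (↭-length; ++⁺ˡ; ++⁺ʳ; shift; filter-↭)
open import Data.Fin using (Fin)
open import Data.Product using (Σ; _×_; _,_)
open import Data.Sum using (_⊎_; inj₁; inj₂)
open import Data.Empty using (⊥-elim)
open import Relation.Nullary using (¬_; Dec; yes; no; ¬?)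
open import Relation.Nullary.Decidable using (_⊎-dec_)
open import Relation.Binary.PropositionalEquality using (_≡_; refl; sym; trans; cong; subst)

module _ {n : ℕ} (T : OrientedGraph n) where
  open OrientedGraph T

  PathCoverOf : List (Fin n) → ℕ → Set
  PathCoverOf L k = Σ (List (List (Fin n))) λ ps → All (IsPath T) ps × concat ps ↭ L × length ps ≤ k

  module _ (x : Fin n) where

    Adjacent : Fin n → Set
    Adjacent y = Arc x y ⊎ Arc y x

    adjacent? : ∀ y → Dec (Adjacent y)
    adjacent? y = arc? x y ⊎-dec arc? y x

    nonAdjacent? : ∀ y → Dec (¬ Adjacent y)
    nonAdjacent? y = ¬? (adjacent? y)

    ¬adjacent-self : ¬ Adjacent x
    ¬adjacent-self (inj₁ xx) = loopless x xx
    ¬adjacent-self (inj₂ xx) = loopless x xx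

    nonAdjacentCount : List (Fin n) → ℕ
    nonAdjacentCount L = length (filter nonAdjacent? L)

    nonAdjacentCount-++ : ∀ L M → nonAdjacentCount (L ++ M) ≡ nonAdjacentCount L + nonAdjacentCount M
    nonAdjacentCount-++ L M =
      trans (cong length (filter-++ nonAdjacent? L M)) (length-++ (filter nonAdjacent? L))

    nonAdjacentCount-↭ : ∀ {L M} → L ↭ M → nonAdjacentCount L ≡ nonAdjacentCount M
    nonAdjacentCount-↭ L↭M = ↭-length (filter-↭ nonAdjacent? L↭M)

    -- Asymmetry makes the three counts of a vertex y disjoint.
    outdeg+indeg+nonAdjacentCount≤length : ∀ L →
      length (filter (arc? x) L) + length (filter (λ y → arc? y x) L) + nonAdjacentCount L ≤ length L
    outdeg+indeg+nonAdjacentCount≤length [] = z≤n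
    outdeg+indeg+nonAdjacentCount≤length (y ∷ L)
      with arc? x y | arc? y x | outdeg+indeg+nonAdjacentCount≤length L
    ... | yes xy | yes yx | _ = ⊥-elim (asymmetric x y xy yx)
    ... | yes _  | no _   | ih = s≤s ih
    ... | no _   | yes _  | ih =
      subst (_≤ suc (length L)) (cong (_+ nonAdjacentCount L) (sym (+-suc _ _))) (s≤s ih)
    ... | no _   | no _   | ih = subst (_≤ suc (length L)) (sym (+-suc _ _)) (s≤s ih)

    deg+nonAdjacentCount≤n : deg T x + nonAdjacentCount (allFin n) ≤ n
    deg+nonAdjacentCount≤n =
      subst (deg T x + nonAdjacentCount (allFin n) ≤_) (length-tabulate (λ i → i))
            (outdeg+indeg+nonAdjacentCount≤length (allFin n))

    suc-nonAdjacentCount-suffix≤ : ∀ pre L → pre ++ x ∷ L ≡ allFin n →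
      suc (nonAdjacentCount L) ≤ nonAdjacentCount (allFin n)
    suc-nonAdjacentCount-suffix≤ pre L suffix = begin
      suc (nonAdjacentCount L)                        ≡⟨ cong length (filter-accept nonAdjacent? ¬adjacent-self) ⟨
      nonAdjacentCount (x ∷ L)                        ≤⟨ m≤n+m _ (nonAdjacentCount pre) ⟩
      nonAdjacentCount pre + nonAdjacentCount (x ∷ L) ≡⟨ nonAdjacentCount-++ pre (x ∷ L) ⟨
      nonAdjacentCount (pre ++ x ∷ L)                 ≡⟨ cong nonAdjacentCount suffix ⟩
      nonAdjacentCount (allFin n)                     ∎
      where open ≤-Reasoning

    insertAfter : ∀ w ys → Arc w x → All Adjacent ys → IsPath T (w ∷ ys) →
                  Σ (List (Fin n)) λ q → IsPath T (w ∷ q) × q ↭ x ∷ ys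
    insertAfter w [] wx [] _ = [ x ] , step w x wx (single x) , ↭-refl
    insertAfter w (y ∷ ys) wx (xy⊎yx ∷ adj) (step _ _ wy path) with arc? x y | xy⊎yx
    ... | yes xy | _       = x ∷ y ∷ ys , step w x wx (step x y xy path) , ↭-refl
    ... | no ¬xy | inj₁ xy = ⊥-elim (¬xy xy)
    ... | no _   | inj₂ yx with insertAfter y ys yx adj path
    ...   | q , path′ , q↭ = y ∷ q , step w y wy path′ , ↭-trans (prep y q↭) (swap y x ↭-refl)

    insert : ∀ p → All Adjacent p → IsPath T p → Σ (List (Fin n)) λ q → IsPath T q × q ↭ x ∷ p
    insert (y ∷ ys) (xy⊎yx ∷ adj) path with arc? x y | xy⊎yx
    ... | yes xy | _       = x ∷ y ∷ ys , step x y xy path , ↭-refl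
    ... | no ¬xy | inj₁ xy = ⊥-elim (¬xy xy)
    ... | no _   | inj₂ yx with insertAfter y ys yx adj path
    ...   | q , path′ , q↭ = y ∷ q , path′ , ↭-trans (prep y q↭) (swap y x ↭-refl)

    insertIntoSome : ∀ ps → Any (All Adjacent) ps → All (IsPath T) ps →
      Σ (List (List (Fin n))) λ ps′ →
        All (IsPath T) ps′ × concat ps′ ↭ x ∷ concat ps × length ps′ ≡ length ps
    insertIntoSome (p ∷ ps) (here adj) (path ∷ paths) with insert p adj path
    ... | q , path′ , q↭ = q ∷ ps , path′ ∷ paths , ++⁺ʳ (concat ps) q↭ , refl
    insertIntoSome (p ∷ ps) (there any) (path ∷ paths) with insertIntoSome ps any paths
    ... | ps′ , paths′ , ps′↭ , len =
      p ∷ ps′ , path ∷ paths′ , ↭-trans (++⁺ˡ p ps′↭) (shift x p (concat ps)) , cong suc len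

    someAllAdjacent⊎length≤nonAdjacentCount : ∀ (ps : List (List (Fin n))) →
      Any (All Adjacent) ps ⊎ length ps ≤ nonAdjacentCount (concat ps)
    someAllAdjacent⊎length≤nonAdjacentCount [] = inj₂ z≤n
    someAllAdjacent⊎length≤nonAdjacentCount (p ∷ ps) with all? adjacent? p
    ... | yes adj = inj₁ (here adj)
    ... | no ¬adj with someAllAdjacent⊎length≤nonAdjacentCount ps
    ...   | inj₁ any = inj₁ (there any)
    ...   | inj₂ len = inj₂ (subst (suc (length ps) ≤_) (sym (nonAdjacentCount-++ p (concat ps)))
                               (+-mono-≤ (filter-some nonAdjacent? (¬All⇒Any¬ adjacent? p ¬adj)) len))

  module _ {k : ℕ} (δ≥n∸k : MinDegreeAtLeast T (n ∸ k)) where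

    nonAdjacentCount≤k : ∀ x → nonAdjacentCount x (allFin n) ≤ k
    nonAdjacentCount≤k x = +-cancelˡ-≤ (n ∸ k) _ _ (begin
      n ∸ k + nonAdjacentCount x (allFin n) ≤⟨ +-mono-≤ (δ≥n∸k x) ≤-refl ⟩
      deg T x + nonAdjacentCount x (allFin n) ≤⟨ deg+nonAdjacentCount≤n x ⟩
      n                                       ≤⟨ m≤n+m∸n n k ⟩
      k + (n ∸ k)                             ≡⟨ +-comm k (n ∸ k) ⟩
      n ∸ k + k                               ∎)
      where open ≤-Reasoning

    extendCover : ∀ x L pre → pre ++ x ∷ L ≡ allFin n → PathCoverOf L k → PathCoverOf (x ∷ L) k
    extendCover x L pre suffix (ps , paths , ps↭L , len≤k) with length ps <? k
    ... | yes len<k = [ x ] ∷ ps , single x ∷ paths , prep x ps↭L , len<k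
    ... | no len≮k with someAllAdjacent⊎length≤nonAdjacentCount x ps
    ...   | inj₁ any with insertIntoSome x ps any paths
    ...     | ps′ , paths′ , ps′↭ , len′ =
      ps′ , paths′ , ↭-trans ps′↭ (prep x ps↭L) , subst (_≤ k) (sym len′) len≤k
    extendCover x L pre suffix (ps , paths , ps↭L , len≤k) | no len≮k | inj₂ len≤count =
      ⊥-elim (n≮n k (begin-strict
        k                             ≤⟨ ≮⇒≥ len≮k ⟩
        length ps                     ≤⟨ len≤count ⟩
        nonAdjacentCount x (concat ps) ≡⟨ nonAdjacentCount-↭ x ps↭L ⟩
        nonAdjacentCount x L          <⟨ suc-nonAdjacentCount-suffix≤ x pre L suffix ⟩
        nonAdjacentCount x (allFin n) ≤⟨ nonAdjacentCount≤k x ⟩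
        k                             ∎))
      where open ≤-Reasoning

    coverSuffix : ∀ L pre → pre ++ L ≡ allFin n → PathCoverOf L k
    coverSuffix []      pre suffix = [] , [] , ↭-refl , z≤n
    coverSuffix (x ∷ L) pre suffix =
      extendCover x L pre suffix (coverSuffix L (pre ++ [ x ]) (trans (++-assoc pre [ x ] L) suffix))

corollary6p4 : (n k : ℕ) (T : OrientedGraph n) →
    MinDegreeAtLeast T (n ∸ k) →
    Σ (List (List (Fin n))) (λ ps → IsPathCover T ps × length ps ≤ k)
corollary6p4 n k T δ≥n∸k with coverSuffix T δ≥n∸k (allFin n) [] refl
... | ps , paths , ps↭allFin , len≤k =
  ps , record { allPaths = All.lookup paths ; partition = ps↭allFin } , len≤k
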